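{- Consider a nontrivial cycle of $C$ with $K$ odd elements and $L$ even elements. Then $\delta<\frac{K+L}{K}<\delta+\frac{1}{3\log(2)}\cdot\frac34\cdot\frac{1}{X_0}.$
   Context: $C(n)=n/2$ for even $n$, $C(n)=(3n+1)/2$ for odd $n$ (on positive integers). A nontrivial cycle is a set $\{n,C(n),\dots,C^{p-1}(n)\}$ with $C^p(n)=n$, different from $\{1,2\}$. $\delta:=\frac{\log 3}{\log 2}$. $X_0$ is a positive integer with $X_0>765$ such that for every positive integer $n\leq X_0$ the sequence $n,C(n),C^2(n),\dots$ eventually reaches $1$. -}

module Defs where

open import Data.Nat using (ℕ; zero; suc; _+_; _*_; _∸_; _^_; _≤_; _<_; _!)
open import Data.Nat.Properties using (_!≢0)
open import Data.Nat.DivMod using (_/_; _%_)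
open import Data.List using (List; []; _∷_; map; filter; length; upTo)
open import Data.Nat.ListAction using (sum)
open import Data.List.Membership.Propositional using (_∈_)
open import Data.List.Relation.Unary.All using (All)
open import Data.Product using (Σ; ∃; _×_)
open import Data.Sum using (_⊎_)
open import Relation.Binary.PropositionalEquality using (_≡_; _≢_)
open import Relation.Nullary using (¬_)
open import Function using (_∘_)

Even Odd : ℕ → Set
Even n = n % 2 ≡ 0
Odd  n = n % 2 ≡ 1

C : ℕ → ℕ
C n with n % 2
... | zero  = n / 2
... | suc _ = (3 * n + 1) / 2

iter : ℕ → ℕ → ℕ
iter zero    n = n
iter (suc k) n = C (iter k n)

ReachesOne : ℕ → Set
ReachesOne n = ∃ λ k → iter k n ≡ 1

IsMinimalPeriod : ℕ → ℕ → Set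
IsMinimalPeriod n p = (0 < p) × (iter p n ≡ n) × (∀ q → 0 < q → q < p → iter q n ≢ n)

cycleElems : ℕ → ℕ → List ℕ
cycleElems n p = map (λ i → iter i n) (upTo p)

IsTrivialCycle : List ℕ → Set
IsTrivialCycle xs = (1 ∈ xs) × (2 ∈ xs) × All (λ m → (m ≡ 1) ⊎ (m ≡ 2)) xs

numOdd numEven : List ℕ → ℕ
numOdd  xs = length (filter (λ m → m % 2 Data.Nat.≟ 1) xs)
numEven xs = length (filter (λ m → m % 2 Data.Nat.≟ 0) xs)

-- Scaled partial sum of the exponential series:
--   expPartialScaled a b N = sum_{j=0}^{N} a^j * b^(N-j) * N!/j!
--                          = b^N * N! * sum_{j=0}^{N} (a/b)^j / j!
expPartialScaled : ℕ → ℕ → ℕ → ℕ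
expPartialScaled a b N =
  sum (map (λ j → a ^ j * b ^ (N ∸ j) * _/_ (N !) (j !) {{j !≢0}}) (upTo (suc N)))

-- For naturals u, v and a, b with b > 0:
--   u < v * exp(a/b)  (real exponential)
-- holds iff some partial sum of the exponential series already exceeds it,
-- i.e. iff  ∃ N, u * b^N * N! < v * expPartialScaled a b N.
LtTimesExp : ℕ → ℕ → ℕ → ℕ → Set
LtTimesExp u v a b = ∃ λ N → u * (b ^ N * N !) < v * expPartialScaled a b N

{-# OPTIONS --safe #-}

-- Along the cycle 2·C(x) = x for even x and 2·C(x) = 3x + 1 for odd x, and C permutes the cycle,
-- so multiplying these identities gives 2^(K+L) = 3^K · ∏_{x odd} (1 + 1/(3x)) > 3^K.
--
-- Every element of a nontrivial cycle exceeds X₀: the orbit of an element is the whole cycle, and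
-- from an element ≤ X₀ it would pass through 1. The termwise bound 1 + 1/(3x) < 1 + 1/(3X₀) is too
-- weak for the upper bound, so the odd steps are compared with 1 + 1/(4X₀) through a potential
-- Φ(x) = x · (1000 X₀ + P(q)). Here q = ⌊100 x / T⌋ ∈ [100, 200) is the position of x relative to
-- its dyadic scale T = 2^a X₀ ≤ x < 2T, and P is an explicit table. Halving x does not change q,
-- so 2 Φ(C x) = Φ(x) on even steps, and a finite check over the pairs of positions joined by an
-- odd step gives 2 · 4X₀ · Φ(C x) < 3 (4X₀ + 1) Φ(x). Around the cycle Φ cancels, leaving
-- 2^(K+L) (4X₀)^K < 3^K (4X₀ + 1)^K, and (1 + 1/b)^K ≤ e^(K/b) is witnessed by the K-th partial sum
-- of the exponential series. Such a table exists because the mean of X₀/x over [X₀, 2X₀) for the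
-- measure dx/x, which the odd steps preserve on the dyadic circle, is 1/(2 ln 2) < 3/4.

module Submission where

open import Defs
open import Data.Nat
open import Data.Nat.Properties
open import Algebra.Properties.CommutativeSemigroup *-commutativeSemigroup using (interchange)
open import Data.Bool using (if_then_else_)
open import Data.List using (List; []; _∷_; map; length; upTo; applyUpTo; _∷ʳ_; head; drop)
open import Data.List.Properties
  using ( length-map; length-upTo; map-∘; map-id; map-id-local; map-cong-local; map-++
        ; map-upTo; map-applyUpTo; upTo-∷ʳ; applyUpTo-∷ʳ)
open import Data.List.Membership.Propositional using (_∈_; find; lose)
open import Data.List.Membership.Propositional.Properties using (∈-map⁺; ∈-map⁻; ∈-upTo⁻; ∈-applyUpTo⁺)
open import Data.List.Relation.Unary.All as All using (All; all?)
open import Data.List.Relation.Unary.All.Properties using (¬Any⇒All¬; map⁺; applyUpTo⁺₁)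
open import Data.List.Relation.Unary.Any as Any using (Any; here; there; any?)
open import Data.List.Relation.Binary.Permutation.Propositional using (_↭_; ↭-sym; module PermutationReasoning)
open import Data.List.Relation.Binary.Permutation.Propositional.Properties as ↭ using (∷↭∷ʳ; ∈-resp-↭)
open import Data.Maybe using (fromMaybe)
open import Data.Nat.DivMod
  using ( _%_; m%n<n; m≡m%n+[m/n]*n; m*[n/m]≡n; m/n*n≤m; m≥n⇒m/n>0; m*n/n≡m; /-monoˡ-≤
        ; m<n*o⇒m/o<n; /-congʳ; m*n/m*o≡n/o; *-/-assoc; n/n≡1)
open import Data.Nat.Divisibility using (divides; m≤n⇒m!∣n!)
open import Data.Nat.Induction using (<-wellFounded)
open import Data.Nat.ListAction using (sum; product)
open import Data.Nat.ListAction.Properties using (sum-++; product-↭; product≢0)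
open import Data.Nat.Logarithm using (⌊log₂_⌋)
open import Data.Nat.Logarithm.Core using (⌊log2⌋)
open import Data.Nat.Tactic.RingSolver using (solve; solve-∀)
open import Data.Product using (_×_; _,_; ∃; proj₁; proj₂)
open import Data.Sum as Sum using (_⊎_; inj₁; inj₂)
open import Function using (_∘_; id)
open import Induction.WellFounded using (Acc; acc)
open import Relation.Nullary using (¬_; yes; no; does; contradiction)
open import Relation.Nullary.Decidable using (Dec; from-yes; _×-dec_; _⊎-dec_; _→-dec_)
open import Relation.Binary.PropositionalEquality

even⊎odd : ∀ x → Even x ⊎ Odd x
even⊎odd x with x % 2 | m%n<n x 2
... | 0           | _ = inj₁ refl
... | 1           | _ = inj₂ refl
... | suc (suc _) | s≤s (s≤s ())

C-even : ∀ x → Even x → 2 * C x ≡ x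
C-even x even with x % 2 | m≡m%n+[m/n]*n x 2
... | 0 | x≡[x/2]*2 = trans (*-comm 2 (x / 2)) (sym x≡[x/2]*2)

C-odd : ∀ x → Odd x → 2 * C x ≡ 3 * x + 1
C-odd x odd with x % 2 | m≡m%n+[m/n]*n x 2
... | 1 | x≡1+[x/2]*2 = m*[n/m]≡n (divides (2 + 3 * (x / 2))
  (trans (cong (λ z → 3 * z + 1) x≡1+[x/2]*2) (3[1+q*2]+1≡[2+3q]*2 (x / 2))))
  where
  3[1+q*2]+1≡[2+3q]*2 : ∀ q → 3 * (1 + q * 2) + 1 ≡ (2 + 3 * q) * 2
  3[1+q*2]+1≡[2+3q]*2 = solve-∀

x<Cx : ∀ x → Odd x → x < C x
x<Cx x odd = *-cancelˡ-< 2 x (C x) (begin-strict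
  2 * x     ≤⟨ *-monoˡ-≤ x {2} {3} (s≤s (s≤s z≤n)) ⟩
  3 * x     <⟨ m<m+n (3 * x) z<s ⟩
  3 * x + 1 ≡⟨ C-odd x odd ⟨
  2 * C x   ∎)
  where open ≤-Reasoning

C-pos : ∀ x → 0 < x → 0 < C x
C-pos x x>0 = *-cancelˡ-< 2 0 (C x) (2*C>0 (even⊎odd x))
  where
  2*C>0 : Even x ⊎ Odd x → 0 < 2 * C x
  2*C>0 (inj₁ even) = subst (0 <_) (sym (C-even x even)) x>0
  2*C>0 (inj₂ odd)  = subst (0 <_) (sym (C-odd x odd)) (≤-<-trans z≤n (m<m+n (3 * x) z<s))

product-map-* : ∀ (f g : ℕ → ℕ) xs → product (map (λ x → f x * g x) xs) ≡ product (map f xs) * product (map g xs)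
product-map-* f g []       = refl
product-map-* f g (x ∷ xs) =
  trans (cong (f x * g x *_) (product-map-* f g xs)) (interchange (f x) (g x) _ _)

product-map-const : ∀ k (xs : List ℕ) → product (map (λ _ → k) xs) ≡ k ^ length xs
product-map-const k []       = refl
product-map-const k (x ∷ xs) = cong (k *_) (product-map-const k xs)

module _ {f g : ℕ → ℕ} where

  product-map-mono-≤ : ∀ {xs} → All (λ x → f x ≤ g x) xs → product (map f xs) ≤ product (map g xs)
  product-map-mono-≤ All.[]              = ≤-refl
  product-map-mono-≤ (fx≤gx All.∷ f≤g) = *-mono-≤ fx≤gx (product-map-mono-≤ f≤g)

  product-map-mono-< : ∀ {xs} → All (λ x → f x ≤ g x) xs → All (λ x → 0 < g x) xs →
                       Any (λ x → f x < g x) xs → product (map f xs) < product (map g xs)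
  product-map-mono-< {x ∷ xs} (_ All.∷ f≤g) (_ All.∷ g>0) (here fx<gx) = begin-strict
    f x * product (map f xs) ≤⟨ *-monoʳ-≤ (f x) (product-map-mono-≤ f≤g) ⟩
    f x * product (map g xs) <⟨ *-monoˡ-< (product (map g xs)) {{product≢0 (map⁺ (All.map >-nonZero g>0))}} fx<gx ⟩
    g x * product (map g xs) ∎
    where open ≤-Reasoning
  product-map-mono-< {x ∷ xs} (fx≤gx All.∷ f≤g) (gx>0 All.∷ g>0) (there f<g) = begin-strict
    f x * product (map f xs) ≤⟨ *-monoˡ-≤ (product (map f xs)) fx≤gx ⟩
    g x * product (map f xs) <⟨ *-monoʳ-< (g x) {{>-nonZero gx>0}} (product-map-mono-< f≤g g>0 f<g) ⟩
    g x * product (map g xs) ∎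
    where open ≤-Reasoning

product-map-<-cancel : ∀ {f g a b : ℕ → ℕ} {xs} → product (map a xs) ≡ product (map b xs) →
  All (λ x → f x * a x ≤ g x * b x) xs → All (λ x → 0 < g x * b x) xs →
  Any (λ x → f x * a x < g x * b x) xs → product (map f xs) < product (map g xs)
product-map-<-cancel {f} {g} {a} {b} {xs} ∏a≡∏b fa≤gb gb>0 fa<gb =
  *-cancelʳ-< (product (map a xs)) _ _ (begin-strict
    product (map f xs) * product (map a xs)    ≡⟨ product-map-* f a xs ⟨
    product (map (λ x → f x * a x) xs)         <⟨ product-map-mono-< fa≤gb gb>0 fa<gb ⟩
    product (map (λ x → g x * b x) xs)         ≡⟨ product-map-* g b xs ⟩
    product (map g xs) * product (map b xs)    ≡⟨ cong (product (map g xs) *_) ∏a≡∏b ⟨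
    product (map g xs) * product (map a xs)    ∎)
  where open ≤-Reasoning

oddWeight : ℕ → ℕ → ℕ
oddWeight B x = if does (x % 2 ≟ 1) then B else 1

oddWeight-odd : ∀ B x → Odd x → oddWeight B x ≡ B
oddWeight-odd B x odd with x % 2 | odd
... | .1 | refl = refl

oddWeight-even : ∀ B x → Even x → oddWeight B x ≡ 1
oddWeight-even B x even with x % 2 | even
... | .0 | refl = refl

oddWeight-pos : ∀ {B} x → 0 < B → 0 < oddWeight B x
oddWeight-pos x B>0 with even⊎odd x
... | inj₁ even = subst (0 <_) (sym (oddWeight-even _ x even)) z<s
... | inj₂ odd  = subst (0 <_) (sym (oddWeight-odd _ x odd)) B>0

product-map-oddWeight : ∀ B xs → product (map (oddWeight B) xs) ≡ B ^ numOdd xs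
product-map-oddWeight B []       = refl
product-map-oddWeight B (x ∷ xs) with x % 2 | even⊎odd x
... | .0 | inj₁ refl = trans (+-identityʳ _) (product-map-oddWeight B xs)
... | .1 | inj₂ refl = cong (B *_) (product-map-oddWeight B xs)

numOdd+numEven≡length : ∀ xs → numOdd xs + numEven xs ≡ length xs
numOdd+numEven≡length []       = refl
numOdd+numEven≡length (x ∷ xs) with x % 2 | even⊎odd x
... | .0 | inj₁ refl = trans (+-suc _ _) (cong suc (numOdd+numEven≡length xs))
... | .1 | inj₂ refl = cong suc (numOdd+numEven≡length xs)

¬odd⇒even : ∀ x → ¬ Odd x → Even x
¬odd⇒even x ¬odd with even⊎odd x
... | inj₁ even = even
... | inj₂ odd  = contradiction odd ¬odd

oddWeight3*x<2*Cx : ∀ x → Odd x → oddWeight 3 x * x < 2 * C x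
oddWeight3*x<2*Cx x odd = begin-strict
  oddWeight 3 x * x ≡⟨ cong (_* x) (oddWeight-odd 3 x odd) ⟩
  3 * x             <⟨ m<m+n (3 * x) z<s ⟩
  3 * x + 1         ≡⟨ C-odd x odd ⟨
  2 * C x           ∎
  where open ≤-Reasoning

oddWeight3*x≤2*Cx : ∀ x → oddWeight 3 x * x ≤ 2 * C x
oddWeight3*x≤2*Cx x with even⊎odd x
... | inj₁ even = ≤-reflexive (begin
  oddWeight 3 x * x ≡⟨ cong (_* x) (oddWeight-even 3 x even) ⟩
  1 * x             ≡⟨ *-identityˡ x ⟩
  x                 ≡⟨ C-even x even ⟨
  2 * C x           ∎)
  where open ≡-Reasoning
... | inj₂ odd  = <⇒≤ (oddWeight3*x<2*Cx x odd)

module _ {xs : List ℕ} (invariant : map C xs ↭ xs) where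

  C-∈ : ∀ {m} → m ∈ xs → C m ∈ xs
  C-∈ m∈ = ∈-resp-↭ invariant (∈-map⁺ C m∈)

  iter-∈ : ∀ {m} → m ∈ xs → ∀ k → iter k m ∈ xs
  iter-∈ m∈ zero    = m∈
  iter-∈ m∈ (suc k) = C-∈ (iter-∈ m∈ k)

  product-map-C : ∀ h → product (map (h ∘ C) xs) ≡ product (map h xs)
  product-map-C h = trans (cong product (map-∘ xs)) (product-↭ (↭.map⁺ h invariant))

  C-invariant-has-odd : 0 < length xs → All (0 <_) xs → Any Odd xs
  C-invariant-has-odd len>0 pos with any? (λ x → x % 2 ≟ 1) xs
  ... | yes someOdd = someOdd
  ... | no noOdd    = contradiction (begin-strict
      product xs                                        <⟨ m<m*n (product xs) (2 ^ length xs) 1<2^len ⟩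
      product xs * 2 ^ length xs                        ≡⟨ *-comm (product xs) _ ⟩
      2 ^ length xs * product xs                        ≡⟨ cong₂ _*_ (product-map-const 2 xs) (product-↭ invariant) ⟨
      product (map (λ _ → 2) xs) * product (map C xs)   ≡⟨ product-map-* (λ _ → 2) C xs ⟨
      product (map (λ x → 2 * C x) xs)
        ≡⟨ cong product (map-id-local (All.map (λ {x} → C-even x) evens)) ⟩
      product xs                                        ∎) (<-irrefl refl)
    where
    open ≤-Reasoning
    evens : All Even xs
    evens = All.map (λ {x} → ¬odd⇒even x) (¬Any⇒All¬ xs noOdd)
    instance
      ∏≢0 : NonZero (product xs)
      ∏≢0 = product≢0 (All.map >-nonZero pos)
    1<2^len : 1 < 2 ^ length xs
    1<2^len = ^-monoʳ-< 2 (s≤s (s≤s z≤n)) len>0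

  3^numOdd<2^length : All (0 <_) xs → Any Odd xs → 3 ^ numOdd xs < 2 ^ length xs
  3^numOdd<2^length pos someOdd = subst₂ _<_ (product-map-oddWeight 3 xs) (product-map-const 2 xs)
    (product-map-<-cancel {f = oddWeight 3} {g = λ _ → 2} {a = id} {b = C} ∏id≡∏C
      (All.tabulate λ {x} _ → oddWeight3*x≤2*Cx x) (All.map (λ {x} x>0 → *-monoʳ-< 2 (C-pos x x>0)) pos)
      (Any.map (λ {x} → oddWeight3*x<2*Cx x) someOdd))
    where
    ∏id≡∏C : product (map id xs) ≡ product (map C xs)
    ∏id≡∏C = trans (cong product (map-id xs)) (sym (product-↭ invariant))

iter-+ : ∀ a b n → iter (a + b) n ≡ iter a (iter b n)
iter-+ zero    b n = refl
iter-+ (suc a) b n = cong C (iter-+ a b n)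

iter-pos : ∀ {n} → 0 < n → ∀ t → 0 < iter t n
iter-pos n>0 zero    = n>0
iter-pos n>0 (suc t) = C-pos (iter t _) (iter-pos n>0 t)

iter-from-1 : ∀ t → iter t 1 ≡ 1 ⊎ iter t 1 ≡ 2
iter-from-1 zero = inj₁ refl
iter-from-1 (suc t) with iter-from-1 t
... | inj₁ iterₜ≡1 = inj₂ (cong C iterₜ≡1)
... | inj₂ iterₜ≡2 = inj₁ (cong C iterₜ≡2)

∈-cycleElems⁻ : ∀ {m n p} → m ∈ cycleElems n p → ∃ λ t → t < p × m ≡ iter t n
∈-cycleElems⁻ {n = n} m∈ with t , t∈ , m≡ ← ∈-map⁻ (λ i → iter i n) m∈ = t , ∈-upTo⁻ t∈ , m≡

cycleElems-pos : ∀ {m n p} → 0 < n → m ∈ cycleElems n p → 0 < m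
cycleElems-pos n>0 m∈ with t , _ , refl ← ∈-cycleElems⁻ m∈ = iter-pos n>0 t

length-cycleElems : ∀ n p → length (cycleElems n p) ≡ p
length-cycleElems n p = trans (length-map (λ i → iter i n) (upTo p)) (length-upTo p)

cycleElems-↭ : ∀ {n p} → 0 < p → iter p n ≡ n → map C (cycleElems n p) ↭ cycleElems n p
cycleElems-↭ {n} {suc q} _ iterₚ≡n = begin
  map C (map orbit (upTo (suc q)))        ≡⟨ cong (map C) (map-upTo orbit (suc q)) ⟩
  map C (applyUpTo orbit (suc q))         ≡⟨ map-applyUpTo orbit C (suc q) ⟩
  applyUpTo (orbit ∘ suc) (suc q)         ≡⟨ sym (applyUpTo-∷ʳ (orbit ∘ suc) q) ⟩
  applyUpTo (orbit ∘ suc) q ∷ʳ iter (suc q) n ≡⟨ cong (applyUpTo (orbit ∘ suc) q ∷ʳ_) iterₚ≡n ⟩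
  applyUpTo (orbit ∘ suc) q ∷ʳ n          ↭⟨ ↭-sym (∷↭∷ʳ n _) ⟩
  applyUpTo orbit (suc q)                 ≡⟨ sym (map-upTo orbit (suc q)) ⟩
  map orbit (upTo (suc q))                ∎
  where
  open PermutationReasoning
  orbit : ℕ → ℕ
  orbit i = iter i n

through-1⇒trivial : ∀ {n p} → 0 < p → iter p n ≡ n → 1 ∈ cycleElems n p → IsTrivialCycle (cycleElems n p)
through-1⇒trivial {n} {p} p>0 iterₚ≡n 1∈ with s , s<p , 1≡iterₛn ← ∈-cycleElems⁻ 1∈ =
  1∈ , C-∈ (cycleElems-↭ p>0 iterₚ≡n) 1∈ , All.tabulate in-orbit-of-1
  where
  n≡iter[p∸s]1 : n ≡ iter (p ∸ s) 1
  n≡iter[p∸s]1 = begin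
    n                       ≡⟨ sym iterₚ≡n ⟩
    iter p n                ≡⟨ cong (λ k → iter k n) (sym (m∸n+n≡m (<⇒≤ s<p))) ⟩
    iter (p ∸ s + s) n      ≡⟨ iter-+ (p ∸ s) s n ⟩
    iter (p ∸ s) (iter s n) ≡⟨ cong (iter (p ∸ s)) (sym 1≡iterₛn) ⟩
    iter (p ∸ s) 1          ∎
    where open ≡-Reasoning
  in-orbit-of-1 : ∀ {m} → m ∈ cycleElems n p → m ≡ 1 ⊎ m ≡ 2
  in-orbit-of-1 {m} m∈ with t , _ , m≡iterₜn ← ∈-cycleElems⁻ m∈ =
    subst (λ k → k ≡ 1 ⊎ k ≡ 2) (sym m≡iter[t+p∸s]1) (iter-from-1 (t + (p ∸ s)))
    where
    m≡iter[t+p∸s]1 : m ≡ iter (t + (p ∸ s)) 1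
    m≡iter[t+p∸s]1 = trans m≡iterₜn (trans (cong (iter t) n≡iter[p∸s]1) (sym (iter-+ t (p ∸ s) 1)))

nontrivial-cycle-above : ∀ {X₀ n p} → (∀ m → 1 ≤ m → m ≤ X₀ → ReachesOne m) → 0 < n →
  0 < p → iter p n ≡ n → ¬ IsTrivialCycle (cycleElems n p) → All (X₀ <_) (cycleElems n p)
nontrivial-cycle-above {X₀} {n} {p} reachesOne n>0 p>0 iterₚn≡n nontrivial = All.tabulate above
  where
  above : ∀ {m} → m ∈ cycleElems n p → X₀ < m
  above {m} m∈ with m ≤? X₀
  ... | no m≰X₀ = ≰⇒> m≰X₀
  ... | yes m≤X₀ with k , iterₖm≡1 ← reachesOne m (cycleElems-pos n>0 m∈) m≤X₀ =
    contradiction (through-1⇒trivial p>0 iterₚn≡n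
                     (subst (_∈ cycleElems n p) iterₖm≡1 (iter-∈ (cycleElems-↭ p>0 iterₚn≡n) m∈ k)))
                  nontrivial

-- Dyadic scale and position

2*⌊n/2⌋≤n : ∀ n → 2 * ⌊ n /2⌋ ≤ n
2*⌊n/2⌋≤n 0             = z≤n
2*⌊n/2⌋≤n 1             = z≤n
2*⌊n/2⌋≤n (suc (suc n)) = subst (_≤ 2 + n) (sym (*-suc 2 ⌊ n /2⌋)) (s≤s (s≤s (2*⌊n/2⌋≤n n)))

n≤1+2*⌊n/2⌋ : ∀ n → n ≤ 1 + 2 * ⌊ n /2⌋
n≤1+2*⌊n/2⌋ 0             = z≤n
n≤1+2*⌊n/2⌋ 1             = ≤-refl
n≤1+2*⌊n/2⌋ (suc (suc n)) = subst (2 + n ≤_) (cong suc (sym (*-suc 2 ⌊ n /2⌋))) (s≤s (s≤s (n≤1+2*⌊n/2⌋ n)))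

2^⌊log₂n⌋≤n : ∀ n .{{_ : NonZero n}} → 2 ^ ⌊log₂ n ⌋ ≤ n
2^⌊log₂n⌋≤n n = 2^⌊log2⌋n≤n n (<-wellFounded n)
  where
  2^⌊log2⌋n≤n : ∀ n .{{_ : NonZero n}} (rec : Acc _<_ n) → 2 ^ ⌊log2⌋ n rec ≤ n
  2^⌊log2⌋n≤n 1             _        = ≤-refl
  2^⌊log2⌋n≤n (suc (suc n)) (acc rs) = begin
    2 * 2 ^ ⌊log2⌋ (suc ⌊ n /2⌋) _ ≤⟨ *-monoʳ-≤ 2 (2^⌊log2⌋n≤n (suc ⌊ n /2⌋) _) ⟩
    2 * suc ⌊ n /2⌋                ≡⟨ *-suc 2 ⌊ n /2⌋ ⟩
    2 + 2 * ⌊ n /2⌋                ≤⟨ +-monoʳ-≤ 2 (2*⌊n/2⌋≤n n) ⟩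
    2 + n                          ∎
    where open ≤-Reasoning

n<2^[1+⌊log₂n⌋] : ∀ n → n < 2 ^ suc ⌊log₂ n ⌋
n<2^[1+⌊log₂n⌋] n = n<2^[1+⌊log2⌋n] n (<-wellFounded n)
  where
  n<2^[1+⌊log2⌋n] : ∀ n (rec : Acc _<_ n) → n < 2 ^ suc (⌊log2⌋ n rec)
  n<2^[1+⌊log2⌋n] 0             _        = z<s
  n<2^[1+⌊log2⌋n] 1             _        = s<s z<s
  n<2^[1+⌊log2⌋n] (suc (suc n)) (acc rs) = begin-strict
    2 + n                              ≤⟨ +-monoʳ-≤ 2 (n≤1+2*⌊n/2⌋ n) ⟩
    3 + 2 * ⌊ n /2⌋                    <⟨ n<1+n _ ⟩
    4 + 2 * ⌊ n /2⌋                    ≡⟨ 2*[2+h] ⌊ n /2⌋ ⟨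
    2 * (2 + ⌊ n /2⌋)                  ≤⟨ *-monoʳ-≤ 2 (n<2^[1+⌊log2⌋n] (suc ⌊ n /2⌋) _) ⟩
    2 * 2 ^ suc (⌊log2⌋ (suc ⌊ n /2⌋) _) ∎
    where
    open ≤-Reasoning
    2*[2+h] : ∀ h → 2 * (2 + h) ≡ 4 + 2 * h
    2*[2+h] = solve-∀

m<[1+m/n]*n : ∀ m n .{{_ : NonZero n}} → m < suc (m / n) * n
m<[1+m/n]*n m n = begin-strict
  m               ≡⟨ m≡m%n+[m/n]*n m n ⟩
  m % n + m / n * n <⟨ +-monoˡ-< (m / n * n) (m%n<n m n) ⟩
  n + m / n * n   ∎
  where open ≤-Reasoning

Cx<4T : ∀ {x T} → 0 < x → x < 2 * T → Odd x → C x < 2 * (2 * T)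
Cx<4T {x} {T} x>0 x<2T odd = *-cancelˡ-< 2 (C x) _ (begin-strict
  2 * C x                 ≡⟨ C-odd x odd ⟩
  3 * x + 1               ≤⟨ +-monoʳ-≤ (3 * x) x>0 ⟩
  3 * x + x               ≡⟨ +-comm (3 * x) x ⟩
  4 * x                   <⟨ *-monoʳ-< 4 x<2T ⟩
  4 * (2 * T)             ≡⟨ *-assoc 2 2 (2 * T) ⟩
  2 * (2 * (2 * T))       ∎)
  where open ≤-Reasoning

module DyadicScale (X : ℕ) .{{_ : NonZero X}} where

  level : ℕ → ℕ
  level x = ⌊log₂ (x / X) ⌋

  scale : ℕ → ℕ
  scale x = 2 ^ level x * X

  instance
    scale≢0 : ∀ {x} → NonZero (scale x)
    scale≢0 {x} = m*n≢0 (2 ^ level x) X {{m^n≢0 2 (level x)}}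

  2^[1+a]*X : ∀ a → 2 ^ suc a * X ≡ 2 * (2 ^ a * X)
  2^[1+a]*X a = *-assoc 2 (2 ^ a) X

  X≤scale : ∀ x → X ≤ scale x
  X≤scale x = m≤n*m X (2 ^ level x) {{m^n≢0 2 (level x)}}

  scale-bracket : ∀ {x} → X ≤ x → scale x ≤ x × x < 2 * scale x
  scale-bracket {x} X≤x = lower , upper
    where
    instance
      x/X≢0 : NonZero (x / X)
      x/X≢0 = >-nonZero (m≥n⇒m/n>0 X≤x)
    lower : scale x ≤ x
    lower = ≤-trans (*-monoˡ-≤ X (2^⌊log₂n⌋≤n (x / X))) (m/n*n≤m x X)
    upper : x < 2 * scale x
    upper = begin-strict
      x                      <⟨ m<[1+m/n]*n x X ⟩
      suc (x / X) * X        ≤⟨ *-monoˡ-≤ X (n<2^[1+⌊log₂n⌋] (x / X)) ⟩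
      2 ^ suc (level x) * X  ≡⟨ 2^[1+a]*X (level x) ⟩
      2 * scale x            ∎
      where open ≤-Reasoning

  dyadic-≤ : ∀ {x} a b → 2 ^ a * X ≤ x → x < 2 * (2 ^ b * X) → a ≤ b
  dyadic-≤ {x} a b lower upper = ≮⇒≥ λ b<a → <⇒≱ 2^a<2^[1+b] (^-monoʳ-≤ 2 b<a)
    where
    2^a<2^[1+b] : 2 ^ a < 2 ^ suc b
    2^a<2^[1+b] = *-cancelʳ-< X _ _ (≤-<-trans lower (subst (x <_) (sym (2^[1+a]*X b)) upper))

  scale-unique : ∀ {x} a → 2 ^ a * X ≤ x → x < 2 * (2 ^ a * X) → scale x ≡ 2 ^ a * X
  scale-unique {x} a lower upper = cong (λ l → 2 ^ l * X) (≤-antisym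
    (dyadic-≤ (level x) a (proj₁ bracket) upper) (dyadic-≤ a (level x) lower (proj₂ bracket)))
    where
    bracket : scale x ≤ x × x < 2 * scale x
    bracket = scale-bracket (≤-trans (m≤n*m X (2 ^ a) {{m^n≢0 2 a}}) lower)

  scale-double : ∀ {y} → X ≤ y → scale (2 * y) ≡ 2 * scale y
  scale-double {y} X≤y with lower , upper ← scale-bracket X≤y =
    trans (scale-unique (suc (level y)) (subst (_≤ 2 * y) (sym (2^[1+a]*X (level y))) (*-monoʳ-≤ 2 lower))
                                        (subst (λ T → 2 * y < 2 * T) (sym (2^[1+a]*X (level y))) (*-monoʳ-< 2 upper)))
          (2^[1+a]*X (level y))

  scale-odd-step : ∀ {x} → X ≤ x → Odd x → scale (C x) ≡ scale x ⊎ scale (C x) ≡ 2 * scale x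
  scale-odd-step {x} X≤x odd with lower , upper ← scale-bracket X≤x | C x <? 2 * scale x
  ... | yes Cx<2T = inj₁ (scale-unique (level x) (≤-trans lower (<⇒≤ (x<Cx x odd))) Cx<2T)
  ... | no  Cx≮2T = inj₂ (trans
    (scale-unique (suc (level x)) (subst (_≤ C x) (sym (2^[1+a]*X (level x))) (≮⇒≥ Cx≮2T))
                                  (subst (λ T → C x < 2 * T) (sym (2^[1+a]*X (level x)))
                                         (Cx<4T {T = scale x} (≤-trans (>-nonZero⁻¹ X) X≤x) upper odd)))
    (2^[1+a]*X (level x)))

-- The certificate

-- P(100), …, P(199); offset is only ever applied to positions in [100, 200).
offsetTable : List ℕ
offsetTable =
  107 ∷ 99 ∷ 91 ∷ 124 ∷ 120 ∷ 115 ∷ 104 ∷ 100 ∷ 96 ∷ 88 ∷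
  78 ∷ 64 ∷ 49 ∷ 46 ∷ 44 ∷ 41 ∷ 39 ∷ 84 ∷ 81 ∷ 78 ∷
  62 ∷ 79 ∷ 76 ∷ 71 ∷ 61 ∷ 51 ∷ 46 ∷ 29 ∷ 14 ∷ 11 ∷
  8 ∷ 6 ∷ 4 ∷ 108 ∷ 106 ∷ 97 ∷ 87 ∷ 119 ∷ 117 ∷ 111 ∷
  104 ∷ 103 ∷ 90 ∷ 84 ∷ 78 ∷ 76 ∷ 68 ∷ 56 ∷ 40 ∷ 38 ∷
  22 ∷ 18 ∷ 14 ∷ 13 ∷ 9 ∷ 50 ∷ 48 ∷ 47 ∷ 43 ∷ 38 ∷
  21 ∷ 37 ∷ 36 ∷ 31 ∷ 25 ∷ 24 ∷ 12 ∷ 2 ∷ 0 ∷ 0 ∷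
  0 ∷ 0 ∷ 0 ∷ 0 ∷ 0 ∷ 0 ∷ 0 ∷ 48 ∷ 47 ∷ 44 ∷
  33 ∷ 32 ∷ 53 ∷ 52 ∷ 49 ∷ 48 ∷ 41 ∷ 34 ∷ 31 ∷ 30 ∷
  16 ∷ 9 ∷ 3 ∷ 2 ∷ 0 ∷ 0 ∷ 0 ∷ 0 ∷ 0 ∷ 0 ∷ []

offset : ℕ → ℕ
offset q = fromMaybe 0 (head (drop (q ∸ 100) offsetTable))

-- [3q/2, 3(q+1)/2] meets [k r, k (r + 1)]: an odd step multiplies x by about 3/2 and its scale by k.
Overlap : ℕ → ℕ → ℕ → Set
Overlap k q r = 2 * k * r ≤ 3 * suc q × 3 * q < 2 * k * suc r

slopeˡ : ℕ → ℕ → ℕ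
slopeˡ q r = 12 * q * offset r + 400000

slopeʳ : ℕ → ℕ
slopeʳ q = 3000 * q + 12 * q * offset q

-- Two affine functions of X, compared at X = 766 together with their slopes (see affine-<-mono).
Certified : ℕ → ℕ → Set
Certified q r = slopeˡ q r ≤ slopeʳ q × slopeˡ q r * 766 + 400 * offset r < slopeʳ q * 766 + 3 * q * offset q

positions : List ℕ
positions = applyUpTo (100 +_) 100

certificate : All (λ q → All (λ r → Overlap 1 q r ⊎ Overlap 2 q r → Certified q r) positions) positions
certificate = from-yes
  (all? (λ q → all? (λ r → (overlap? 1 q r ⊎-dec overlap? 2 q r) →-dec certified? q r) positions) positions)
  where
  overlap? : ∀ k q r → Dec (Overlap k q r)
  overlap? k q r = (2 * k * r ≤? 3 * suc q) ×-dec (3 * q <? 2 * k * suc r)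
  certified? : ∀ q r → Dec (Certified q r)
  certified? q r = (slopeˡ q r ≤? slopeʳ q) ×-dec (slopeˡ q r * 766 + 400 * offset r <? slopeʳ q * 766 + 3 * q * offset q)

∈-positions : ∀ {q} → 100 ≤ q → q < 200 → q ∈ positions
∈-positions {q} 100≤q q<200 =
  subst (_∈ positions) (m+[n∸m]≡n 100≤q) (∈-applyUpTo⁺ (100 +_) (∸-monoˡ-< q<200 100≤q))

certified : ∀ {q r} → 100 ≤ q × q < 200 → 100 ≤ r × r < 200 → Overlap 1 q r ⊎ Overlap 2 q r → Certified q r
certified (100≤q , q<200) (100≤r , r<200) =
  All.lookup (All.lookup certificate (∈-positions 100≤q q<200)) (∈-positions 100≤r r<200)

odd-step-overlap : ∀ {x y q r T} k → 100 ≤ T → 2 * y ≡ 3 * x + 1 →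
          q * T ≤ 100 * x → 100 * x < suc q * T → r * (k * T) ≤ 100 * y → 100 * y < suc r * (k * T) →
          Overlap k q r
odd-step-overlap {x} {y} {q} {r} {T} k 100≤T 2y≡3x+1 qT≤100x 100x<[1+q]T rkT≤100y 100y<[1+r]kT =
  ≤-pred 2kr<1+3[1+q] , 3q<2k[1+r]
  where
  open ≤-Reasoning
  2*100y≡3*100x+100 : 2 * (100 * y) ≡ 3 * (100 * x) + 100
  2*100y≡3*100x+100 = begin-equality
    2 * (100 * y)       ≡⟨ solve (y ∷ []) ⟩
    100 * (2 * y)       ≡⟨ cong (100 *_) 2y≡3x+1 ⟩
    100 * (3 * x + 1)   ≡⟨ solve (x ∷ []) ⟩
    3 * (100 * x) + 100 ∎
  2kr<1+3[1+q] : 2 * k * r < suc (3 * suc q)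
  2kr<1+3[1+q] = *-cancelʳ-< T _ _ (begin-strict
    2 * k * r * T         ≡⟨ solve (k ∷ r ∷ T ∷ []) ⟩
    2 * (r * (k * T))     ≤⟨ *-monoʳ-≤ 2 rkT≤100y ⟩
    2 * (100 * y)         ≡⟨ 2*100y≡3*100x+100 ⟩
    3 * (100 * x) + 100   <⟨ +-monoˡ-< 100 (*-monoʳ-< 3 100x<[1+q]T) ⟩
    3 * (suc q * T) + 100 ≤⟨ +-monoʳ-≤ (3 * (suc q * T)) 100≤T ⟩
    3 * (suc q * T) + T   ≡⟨ solve (q ∷ T ∷ []) ⟩
    suc (3 * suc q) * T   ∎)
  3q<2k[1+r] : 3 * q < 2 * k * suc r
  3q<2k[1+r] = *-cancelʳ-< T _ _ (begin-strict
    3 * q * T             ≡⟨ *-assoc 3 q T ⟩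
    3 * (q * T)           ≤⟨ *-monoʳ-≤ 3 qT≤100x ⟩
    3 * (100 * x)         <⟨ m<m+n (3 * (100 * x)) z<s ⟩
    3 * (100 * x) + 100   ≡⟨ 2*100y≡3*100x+100 ⟨
    2 * (100 * y)         <⟨ *-monoʳ-< 2 100y<[1+r]kT ⟩
    2 * (suc r * (k * T)) ≡⟨ solve (k ∷ r ∷ T ∷ []) ⟩
    2 * k * suc r * T     ∎)

affine-<-mono : ∀ {α β u v X₁ X} → α ≤ β → α * X₁ + u < β * X₁ + v → X₁ ≤ X → α * X + u < β * X + v
affine-<-mono {α} {β} {u} {v} {X₁} {X} α≤β at-X₁ X₁≤X = begin-strict
  α * X + u              ≡⟨ cong (λ z → α * z + u) X₁+d≡X ⟨
  α * (X₁ + d) + u       ≡⟨ regroup α X₁ d u ⟩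
  (α * X₁ + u) + α * d   <⟨ +-mono-<-≤ at-X₁ (*-monoˡ-≤ d α≤β) ⟩
  (β * X₁ + v) + β * d   ≡⟨ regroup β X₁ d v ⟨
  β * (X₁ + d) + v       ≡⟨ cong (λ z → β * z + v) X₁+d≡X ⟩
  β * X + v              ∎
  where
  open ≤-Reasoning
  d : ℕ
  d = X ∸ X₁
  X₁+d≡X : X₁ + d ≡ X
  X₁+d≡X = m+[n∸m]≡n X₁≤X
  regroup : ∀ c y z w → c * (y + z) + w ≡ (c * y + w) + c * z
  regroup = solve-∀

affine-<-rescale : ∀ {w m x a d e} → w * a + m * d < w * e → w ≤ m * x → x * a + d < x * e
affine-<-rescale {w} {m} {x} {a} {d} {e} at-w w≤mx = begin-strict
  x * a + d         <⟨ +-monoʳ-< (x * a) d<xδ ⟩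
  x * a + x * δ     ≡⟨ *-distribˡ-+ x a δ ⟨
  x * (a + δ)       ≡⟨ cong (x *_) a+δ≡e ⟩
  x * e             ∎
  where
  open ≤-Reasoning
  a≤e : a ≤ e
  a≤e = <⇒≤ (*-cancelˡ-< w a e (≤-<-trans (m≤m+n (w * a) (m * d)) at-w))
  δ : ℕ
  δ = e ∸ a
  a+δ≡e : a + δ ≡ e
  a+δ≡e = m+[n∸m]≡n a≤e
  md<wδ : m * d < w * δ
  md<wδ = +-cancelˡ-< (w * a) (m * d) (w * δ) (begin-strict
    w * a + m * d   <⟨ at-w ⟩
    w * e           ≡⟨ cong (w *_) a+δ≡e ⟨
    w * (a + δ)     ≡⟨ *-distribˡ-+ w a δ ⟩
    w * a + w * δ   ∎)
  d<xδ : d < x * δ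
  d<xδ = *-cancelˡ-< m d (x * δ) (begin-strict
    m * d           <⟨ md<wδ ⟩
    w * δ           ≤⟨ *-monoˡ-≤ δ w≤mx ⟩
    m * x * δ       ≡⟨ *-assoc m x δ ⟩
    m * (x * δ)     ∎)

-- After cancelling 12000·x·X² on both sides the claim is affine in x, and the hypothesis
-- is that claim, scaled by 100, at the point qX/100 ≤ x.
odd-step-algebra : ∀ {X x q pq pr} .{{_ : NonZero X}} →
  (12 * q * pr + 400000) * X + 400 * pr < (3000 * q + 12 * q * pq) * X + 3 * q * pq →
  q * X ≤ 100 * x →
  (3 * x + 1) * (4 * X) * (1000 * X + pr) < 3 * x * suc (4 * X) * (1000 * X + pq)
odd-step-algebra {X} {x} {q} {pq} {pr} at-X qX≤100x = begin-strict
  (3 * x + 1) * (4 * X) * (1000 * X + pr)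
    ≡⟨ solve (X ∷ x ∷ pr ∷ []) ⟩
  x * (12000 * X * X) + (x * (12 * X * pr) + 4 * X * (1000 * X + pr))
    <⟨ +-monoʳ-< (x * (12000 * X * X)) at-x ⟩
  x * (12000 * X * X) + x * (12 * X * pq + 3 * (1000 * X + pq))
    ≡⟨ solve (X ∷ x ∷ pq ∷ []) ⟩
  3 * x * suc (4 * X) * (1000 * X + pq)
    ∎
  where
  open ≤-Reasoning
  at-qX : q * X * (12 * X * pr) + 100 * (4 * X * (1000 * X + pr)) < q * X * (12 * X * pq + 3 * (1000 * X + pq))
  at-qX = begin-strict
    q * X * (12 * X * pr) + 100 * (4 * X * (1000 * X + pr)) ≡⟨ solve (X ∷ q ∷ pr ∷ []) ⟩
    X * ((12 * q * pr + 400000) * X + 400 * pr)             <⟨ *-monoʳ-< X at-X ⟩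
    X * ((3000 * q + 12 * q * pq) * X + 3 * q * pq)         ≡⟨ solve (X ∷ q ∷ pq ∷ []) ⟩
    q * X * (12 * X * pq + 3 * (1000 * X + pq))             ∎
  at-x : x * (12 * X * pr) + 4 * X * (1000 * X + pr) < x * (12 * X * pq + 3 * (1000 * X + pq))
  at-x = affine-<-rescale {w = q * X} {m = 100} {x = x} at-qX qX≤100x

-- The potential

module Potential (X : ℕ) .{{_ : NonZero X}} where

  open DyadicScale X

  position : ℕ → ℕ
  position x = 100 * x / scale x

  position-bracket : ∀ x → position x * scale x ≤ 100 * x × 100 * x < suc (position x) * scale x
  position-bracket x = m/n*n≤m (100 * x) (scale x) , m<[1+m/n]*n (100 * x) (scale x)

  position-range : ∀ {x} → X ≤ x → 100 ≤ position x × position x < 200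
  position-range {x} X≤x with lower , upper ← scale-bracket X≤x =
    subst (_≤ position x) (m*n/n≡m 100 (scale x)) (/-monoˡ-≤ (scale x) (*-monoʳ-≤ 100 lower)) ,
    m<n*o⇒m/o<n {o = scale x} (begin-strict
      100 * x           <⟨ *-monoʳ-< 100 upper ⟩
      100 * (2 * scale x) ≡⟨ *-assoc 100 2 (scale x) ⟨
      200 * scale x     ∎)
    where open ≤-Reasoning

  position-double : ∀ {y} → X ≤ y → position (2 * y) ≡ position y
  position-double {y} X≤y = begin
    100 * (2 * y) / scale (2 * y)   ≡⟨ /-congʳ {m = 100 * (2 * y)} (scale-double X≤y) ⟩
    100 * (2 * y) / (2 * scale y)   ≡⟨ cong (_/ (2 * scale y)) (solve (y ∷ [])) ⟩
    2 * (100 * y) / (2 * scale y)   ≡⟨ m*n/m*o≡n/o 2 (100 * y) (scale y) ⟩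
    100 * y / scale y               ∎
    where
    open ≡-Reasoning
    instance
      2*scale≢0 : NonZero (2 * scale y)
      2*scale≢0 = m*n≢0 2 (scale y)

  position-odd-step : ∀ {x} → 100 ≤ X → X ≤ x → Odd x →
                      Overlap 1 (position x) (position (C x)) ⊎ Overlap 2 (position x) (position (C x))
  position-odd-step {x} 100≤X X≤x odd =
    Sum.map (λ Tʸ≡Tˣ → overlap-at 1 (trans Tʸ≡Tˣ (sym (*-identityˡ (scale x))))) (overlap-at 2)
            (scale-odd-step X≤x odd)
    where
    overlap-at : ∀ k → scale (C x) ≡ k * scale x → Overlap k (position x) (position (C x))
    overlap-at k Tʸ≡kTˣ with qT≤100x , 100x<[1+q]T ← position-bracket x
                            | rT≤100y , 100y<[1+r]T ← position-bracket (C x) =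
      odd-step-overlap {x = x} {y = C x} k (≤-trans 100≤X (X≤scale x)) (C-odd x odd) qT≤100x 100x<[1+q]T
        (subst (λ T → position (C x) * T ≤ 100 * C x) Tʸ≡kTˣ rT≤100y)
        (subst (λ T → 100 * C x < suc (position (C x)) * T) Tʸ≡kTˣ 100y<[1+r]T)

  density : ℕ → ℕ
  density q = 1000 * X + offset q

  potential : ℕ → ℕ
  potential x = x * density (position x)

  potential-pos : ∀ {x} → 0 < x → 0 < potential x
  potential-pos x>0 = *-mono-≤ x>0 (≤-trans (≤-trans (>-nonZero⁻¹ X) (m≤n*m X 1000)) (m≤m+n _ _))

  potential-double : ∀ {y} → X ≤ y → potential (2 * y) ≡ 2 * potential y
  potential-double {y} X≤y = begin
    2 * y * density (position (2 * y)) ≡⟨ cong (λ q → 2 * y * density q) (position-double X≤y) ⟩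
    2 * y * density (position y)       ≡⟨ *-assoc 2 y _ ⟩
    2 * potential y                    ∎
    where open ≡-Reasoning

  potential-even : ∀ x → X ≤ C x → Even x → 2 * potential (C x) ≡ potential x
  potential-even x X≤Cx even = trans (sym (potential-double X≤Cx)) (cong potential (C-even x even))

  potential-odd : ∀ x → 766 ≤ X → X ≤ x → Odd x → 2 * (4 * X) * potential (C x) < 3 * suc (4 * X) * potential x
  potential-odd x 766≤X X≤x odd = begin-strict
    2 * (4 * X) * (C x * density r)       ≡⟨ regroupˡ (4 * X) (C x) (density r) ⟩
    2 * C x * (4 * X) * density r         ≡⟨ cong (λ z → z * (4 * X) * density r) (C-odd x odd) ⟩
    (3 * x + 1) * (4 * X) * density r     <⟨ odd-step-algebra {x = x} {q = q} {offset q} {offset r} certified-at-X qX≤100x ⟩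
    3 * x * suc (4 * X) * density q       ≡⟨ regroupʳ x (suc (4 * X)) (density q) ⟩
    3 * suc (4 * X) * (x * density q)     ∎
    where
    open ≤-Reasoning
    regroupˡ : ∀ b y d → 2 * b * (y * d) ≡ 2 * y * b * d
    regroupˡ = solve-∀
    regroupʳ : ∀ x b d → 3 * x * b * d ≡ 3 * b * (x * d)
    regroupʳ = solve-∀
    q r : ℕ
    q = position x
    r = position (C x)
    X≤Cx : X ≤ C x
    X≤Cx = ≤-trans X≤x (<⇒≤ (x<Cx x odd))
    certified-qr : Certified q r
    certified-qr = certified (position-range X≤x) (position-range X≤Cx)
                             (position-odd-step (≤-trans (m≤m+n 100 666) 766≤X) X≤x odd)
    certified-at-X : slopeˡ q r * X + 400 * offset r < slopeʳ q * X + 3 * q * offset q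
    certified-at-X = affine-<-mono (proj₁ certified-qr) (proj₂ certified-qr) 766≤X
    qX≤100x : q * X ≤ 100 * x
    qX≤100x = ≤-trans (*-monoʳ-≤ q (X≤scale x)) (proj₁ (position-bracket x))

  potential-step-odd : ∀ x → 766 ≤ X → X ≤ x → Odd x →
    2 * oddWeight (4 * X) x * potential (C x) < oddWeight 3 x * oddWeight (suc (4 * X)) x * potential x
  potential-step-odd x 766≤X X≤x odd = subst₂ _<_
    (cong (λ w → 2 * w * potential (C x)) (sym (oddWeight-odd (4 * X) x odd)))
    (cong₂ (λ u v → u * v * potential x) (sym (oddWeight-odd 3 x odd)) (sym (oddWeight-odd (suc (4 * X)) x odd)))
    (potential-odd x 766≤X X≤x odd)

  potential-step : ∀ x → 766 ≤ X → X ≤ x → X ≤ C x →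
    2 * oddWeight (4 * X) x * potential (C x) ≤ oddWeight 3 x * oddWeight (suc (4 * X)) x * potential x
  potential-step x 766≤X X≤x X≤Cx with even⊎odd x
  ... | inj₂ odd  = <⇒≤ (potential-step-odd x 766≤X X≤x odd)
  ... | inj₁ even = ≤-reflexive (begin
    2 * oddWeight (4 * X) x * potential (C x)
      ≡⟨ cong (λ w → 2 * w * potential (C x)) (oddWeight-even (4 * X) x even) ⟩
    2 * 1 * potential (C x)
      ≡⟨ cong (_* potential (C x)) (*-identityʳ 2) ⟩
    2 * potential (C x)
      ≡⟨ potential-even x X≤Cx even ⟩
    potential x
      ≡⟨ *-identityˡ (potential x) ⟨
    1 * 1 * potential x
      ≡⟨ cong₂ (λ u v → u * v * potential x) (oddWeight-even 3 x even) (oddWeight-even (suc (4 * X)) x even) ⟨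
    oddWeight 3 x * oddWeight (suc (4 * X)) x * potential x
      ∎)
    where open ≡-Reasoning

  2^length*[4X]^numOdd<3^numOdd*[1+4X]^numOdd : ∀ {xs} → map C xs ↭ xs → 766 ≤ X → All (X ≤_) xs → Any Odd xs →
    2 ^ length xs * (4 * X) ^ numOdd xs < 3 ^ numOdd xs * suc (4 * X) ^ numOdd xs
  2^length*[4X]^numOdd<3^numOdd*[1+4X]^numOdd {xs} invariant 766≤X X≤ someOdd = subst₂ _<_
    (trans (product-map-* (λ _ → 2) (oddWeight (4 * X)) xs)
           (cong₂ _*_ (product-map-const 2 xs) (product-map-oddWeight (4 * X) xs)))
    (trans (product-map-* (oddWeight 3) (oddWeight (suc (4 * X))) xs)
           (cong₂ _*_ (product-map-oddWeight 3 xs) (product-map-oddWeight (suc (4 * X)) xs)))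
    (product-map-<-cancel (product-map-C invariant potential)
      (All.tabulate λ {x} x∈ → potential-step x 766≤X (All.lookup X≤ x∈) (All.lookup X≤ (C-∈ invariant x∈)))
      (All.map (λ {x} X≤x → *-mono-≤ (*-mono-≤ (oddWeight-pos x z<s) (oddWeight-pos x z<s))
                                      (potential-pos (≤-trans (>-nonZero⁻¹ X) X≤x))) X≤)
      (strict (find someOdd)))
    where
    strict : ∃ (λ x → x ∈ xs × Odd x) →
             Any (λ x → 2 * oddWeight (4 * X) x * potential (C x) < oddWeight 3 x * oddWeight (suc (4 * X)) x * potential x) xs
    strict (x , x∈ , odd) = lose x∈ (potential-step-odd x 766≤X (All.lookup X≤ x∈) odd)

-- Partial sums of the exponential series

sum-map-*ˡ : ∀ c (f : ℕ → ℕ) xs → sum (map (λ x → c * f x) xs) ≡ c * sum (map f xs)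
sum-map-*ˡ c f []       = sym (*-zeroʳ c)
sum-map-*ˡ c f (x ∷ xs) = trans (cong (c * f x +_) (sum-map-*ˡ c f xs)) (sym (*-distribˡ-+ c (f x) _))

expPartialScaled-suc : ∀ a b N → expPartialScaled a b (suc N) ≡ suc N * b * expPartialScaled a b N + a ^ suc N
expPartialScaled-suc a b N = begin
  sum (map (term (suc N)) (upTo (suc (suc N))))
    ≡⟨ cong (λ js → sum (map (term (suc N)) js)) (upTo-∷ʳ (suc N)) ⟨
  sum (map (term (suc N)) (upTo (suc N) ∷ʳ suc N))
    ≡⟨ cong sum (map-++ (term (suc N)) (upTo (suc N)) (suc N ∷ [])) ⟩
  sum (map (term (suc N)) (upTo (suc N)) ∷ʳ term (suc N) (suc N))
    ≡⟨ sum-++ (map (term (suc N)) (upTo (suc N))) (term (suc N) (suc N) ∷ []) ⟩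
  sum (map (term (suc N)) (upTo (suc N))) + (term (suc N) (suc N) + 0)
    ≡⟨ cong₂ _+_ (cong sum (map-cong-local (applyUpTo⁺₁ (λ j → j) (suc N) term-suc)))
                 (trans (+-identityʳ _) (term-last (suc N))) ⟩
  sum (map (λ j → suc N * b * term N j) (upTo (suc N))) + a ^ suc N
    ≡⟨ cong (_+ a ^ suc N) (sum-map-*ˡ (suc N * b) (term N) (upTo (suc N))) ⟩
  suc N * b * sum (map (term N) (upTo (suc N))) + a ^ suc N
    ∎
  where
  open ≡-Reasoning
  term : ℕ → ℕ → ℕ
  term N j = a ^ j * b ^ (N ∸ j) * _/_ (N !) (j !) {{j !≢0}}
  term-suc : ∀ {j} → j < suc N → term (suc N) j ≡ suc N * b * term N j
  term-suc {j} (s≤s j≤N) = begin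
    a ^ j * b ^ (suc N ∸ j) * _/_ (suc N * N !) (j !) {{j !≢0}}
      ≡⟨ cong₂ (λ e d → a ^ j * b ^ e * d) (+-∸-assoc 1 j≤N)
               (*-/-assoc (suc N) {{j !≢0}} (m≤n⇒m!∣n! j≤N)) ⟩
    a ^ j * (b * b ^ (N ∸ j)) * (suc N * _/_ (N !) (j !) {{j !≢0}})
      ≡⟨ regroup (a ^ j) b (b ^ (N ∸ j)) (suc N) _ ⟩
    suc N * b * term N j
      ∎
    where
    regroup : ∀ x y z w v → x * (y * z) * (w * v) ≡ w * y * (x * z * v)
    regroup = solve-∀
  term-last : ∀ N → term N N ≡ a ^ N
  term-last N rewrite n∸n≡0 N | n/n≡1 (N !) {{N !≢0}} = trans (*-identityʳ _) (*-identityʳ _)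

bernoulli : ∀ a n → a ^ suc n + suc n * a ^ n ≤ suc a ^ suc n
bernoulli a zero    = ≤-reflexive (+-comm (a * 1) 1)
bernoulli a (suc n) = begin
  a ^ suc (suc n) + suc (suc n) * a ^ suc n                   ≤⟨ m≤m+n _ (suc n * a ^ n) ⟩
  a ^ suc (suc n) + suc (suc n) * a ^ suc n + suc n * a ^ n   ≡⟨ regroup a n (a ^ n) ⟩
  suc a * (a ^ suc n + suc n * a ^ n)                         ≤⟨ *-monoʳ-≤ (suc a) (bernoulli a n) ⟩
  suc a ^ suc (suc n)                                         ∎
  where
  open ≤-Reasoning
  regroup : ∀ a n t → a * (a * t) + (2 + n) * (a * t) + (1 + n) * t ≡ (1 + a) * (a * t + (1 + n) * t)
  regroup = solve-∀

-- A discrete E(a + 1) ≥ E(a) + ∂E/∂a, termwise by Bernoulli's inequality.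
expPartialScaled-shift : ∀ a b N →
  expPartialScaled a b (suc N) + suc N * expPartialScaled a b N ≤ expPartialScaled (suc a) b (suc N)
expPartialScaled-shift a b zero    = ≤-reflexive (begin
  expPartialScaled a b 1 + 1                ≡⟨ cong (_+ 1) (expPartialScaled-suc a b 0) ⟩
  (1 * b * 1 + a ^ 1) + 1                   ≡⟨ regroup a b ⟩
  1 * b * 1 + suc a ^ 1                     ≡⟨ expPartialScaled-suc (suc a) b 0 ⟨
  expPartialScaled (suc a) b 1              ∎)
  where
  open ≡-Reasoning
  regroup : ∀ a b → (1 * b * 1 + a * 1) + 1 ≡ 1 * b * 1 + (1 + a) * 1
  regroup = solve-∀
expPartialScaled-shift a b (suc N) = begin
  E a (2 + N) + (2 + N) * E a (1 + N)
    ≡⟨ cong₂ (λ u v → u + (2 + N) * v) (expPartialScaled-suc a b (1 + N)) (expPartialScaled-suc a b N) ⟩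
  ((2 + N) * b * E a (1 + N) + a ^ (2 + N)) + (2 + N) * ((1 + N) * b * E a N + a ^ (1 + N))
    ≡⟨ regroup N b (E a (1 + N)) (E a N) (a ^ (1 + N)) (a ^ (2 + N)) ⟩
  (2 + N) * b * (E a (1 + N) + (1 + N) * E a N) + (a ^ (2 + N) + (2 + N) * a ^ (1 + N))
    ≤⟨ +-mono-≤ (*-monoʳ-≤ ((2 + N) * b) (expPartialScaled-shift a b N)) (bernoulli a (1 + N)) ⟩
  (2 + N) * b * E (suc a) (1 + N) + suc a ^ (2 + N)
    ≡⟨ expPartialScaled-suc (suc a) b (1 + N) ⟨
  E (suc a) (2 + N)
    ∎
  where
  open ≤-Reasoning
  E : ℕ → ℕ → ℕ
  E a N = expPartialScaled a b N
  regroup : ∀ N b E₁ E₀ p₁ p₂ → ((2 + N) * b * E₁ + p₂) + (2 + N) * ((1 + N) * b * E₀ + p₁) ≡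
                               (2 + N) * b * (E₁ + (1 + N) * E₀) + (p₂ + (2 + N) * p₁)
  regroup = solve-∀

[1+b]^N*N!≤expPartialScaled : ∀ b N → suc b ^ N * N ! ≤ expPartialScaled N b N
[1+b]^N*N!≤expPartialScaled b zero    = ≤-refl
[1+b]^N*N!≤expPartialScaled b (suc N) = begin
  suc b ^ suc N * suc N !                                   ≡⟨ regroup (suc b) (suc b ^ N) (suc N) (N !) ⟩
  suc b * suc N * (suc b ^ N * N !)                         ≤⟨ *-monoʳ-≤ (suc b * suc N) ([1+b]^N*N!≤expPartialScaled b N) ⟩
  suc b * suc N * E                                         ≤⟨ m≤m+n _ (N ^ suc N) ⟩
  suc b * suc N * E + N ^ suc N                             ≡⟨ split N b E (N ^ suc N) ⟩
  (suc N * b * E + N ^ suc N) + suc N * E                   ≡⟨ cong (_+ suc N * E) (expPartialScaled-suc N b N) ⟨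
  expPartialScaled N b (suc N) + suc N * E                  ≤⟨ expPartialScaled-shift N b N ⟩
  expPartialScaled (suc N) b (suc N)                        ∎
  where
  open ≤-Reasoning
  E : ℕ
  E = expPartialScaled N b N
  regroup : ∀ x y z w → x * y * (z * w) ≡ x * z * (y * w)
  regroup = solve-∀
  split : ∀ N b E p → (1 + b) * (1 + N) * E + p ≡ ((1 + N) * b * E + p) + (1 + N) * E
  split = solve-∀

LtTimesExp⁺ : ∀ {u v b} N → u * b ^ N < v * suc b ^ N → LtTimesExp u v N b
LtTimesExp⁺ {u} {v} {b} N u*b^N<v*[1+b]^N = N , (begin-strict
  u * (b ^ N * N !)        ≡⟨ *-assoc u (b ^ N) (N !) ⟨
  u * b ^ N * N !          <⟨ *-monoˡ-< (N !) {{N !≢0}} u*b^N<v*[1+b]^N ⟩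
  v * suc b ^ N * N !      ≡⟨ *-assoc v (suc b ^ N) (N !) ⟩
  v * (suc b ^ N * N !)    ≤⟨ *-monoʳ-≤ v ([1+b]^N*N!≤expPartialScaled b N) ⟩
  v * expPartialScaled N b N ∎)
  where open ≤-Reasoning

theorem27 : (X₀ : ℕ) → 765 < X₀ → (∀ m → 1 ≤ m → m ≤ X₀ → ReachesOne m) →
    (n p : ℕ) → 1 ≤ n → IsMinimalPeriod n p → ¬ IsTrivialCycle (cycleElems n p) →
    let K = numOdd (cycleElems n p)
        L = numEven (cycleElems n p)
    in (3 ^ K < 2 ^ (K + L)) × LtTimesExp (2 ^ (K + L)) (3 ^ K) K (4 * X₀)
theorem27 X₀ 765<X₀ reachesOne n p n>0 (p>0 , iterₚn≡n , _) nontrivial =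
  subst (λ ℓ → 3 ^ K < 2 ^ ℓ × LtTimesExp (2 ^ ℓ) (3 ^ K) K (4 * X₀)) (sym (numOdd+numEven≡length cycle))
    ( 3^numOdd<2^length invariant positive someOdd
    , LtTimesExp⁺ {u = 2 ^ length cycle} {v = 3 ^ K} {b = 4 * X₀} K
        (2^length*[4X]^numOdd<3^numOdd*[1+4X]^numOdd invariant 765<X₀ (All.map <⇒≤ large) someOdd))
  where
  instance
    X₀≢0 : NonZero X₀
    X₀≢0 = >-nonZero (≤-<-trans z≤n 765<X₀)
  open Potential X₀
  cycle : List ℕ
  cycle = cycleElems n p
  K : ℕ
  K = numOdd cycle
  invariant : map C cycle ↭ cycle
  invariant = cycleElems-↭ p>0 iterₚn≡n
  large : All (X₀ <_) cycle
  large = nontrivial-cycle-above reachesOne n>0 p>0 iterₚn≡n nontrivial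
  positive : All (0 <_) cycle
  positive = All.map (≤-<-trans z≤n) large
  someOdd : Any Odd cycle
  someOdd = C-invariant-has-odd invariant (subst (0 <_) (sym (length-cycleElems n p)) p>0) positive
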